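{- Let $x_1,x_2,x_3,\ldots$ be pairwise commuting indeterminates. Let $\Gamma=(V,E)$ be the directed graph with vertex set $V=\mathbb{Z}\times\mathbb{Z}$ and edges $(i,j)\to(i,j+1)$ of weight $1$ and $(i,j)\to(i+1,j)$ of weight $x_j-x_{i+j}$, for all $(i,j)\in\mathbb{Z}^2$. For vertices $u,v$, let $e(u,v)$ be the sum, over all directed paths $P$ from $u$ to $v$, of the product of the weights of the edges of $P$. Let $a=(1,1)$ and $b=(m,n)$ with integers $m,n>0$. Then $$e(a,b)=(x_1-x_{m+n-1})\cdots(x_1-x_{n+2})(x_1-x_{n+1})=\prod_{k=n+1}^{m+n-1}(x_1-x_k),$$ where the product is interpreted as $1$ when $m+n-1<n+1$ (i.e. when $m=1$).
   Context: A directed path $v_0\to v_1\to\cdots\to v_k$ (with $k\ge 0$) has weight equal to the product of the weights of its edges; the empty path from a vertex to itself has weight $1$. Since every edge increases a coordinate, there are finitely many paths between any two vertices, so $e(u,v)$ is a polynomial. -}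

module Defs where

open import Level using (Level)
open import Algebra.Bundles using (CommutativeRing)
open import Data.Nat using (ℕ; zero; suc)
open import Data.Integer as ℤ using (ℤ; +_; -[1+_])
open import Data.Product using (_×_; _,_)
open import Data.List using (List; []; _∷_; concatMap)
open import Data.Bool using (if_then_else_)
open import Relation.Nullary.Decidable using (⌊_⌋)
open import Data.Product.Properties using (≡-dec)

Vertex : Set
Vertex = ℤ × ℤ

data Move : Set where
  right up : Move

step : Move → Vertex → Vertex
step right (i , j) = (i ℤ.+ + 1 , j)
step up    (i , j) = (i , j ℤ.+ + 1)

endpoint : Vertex → List Move → Vertex
endpoint u []      = u
endpoint u (s ∷ w) = endpoint (step s u) w

-- all move sequences of length k (a directed path from u is determined by
-- its start and its sequence of moves)
moves : ℕ → List (List Move)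
moves zero    = [] ∷ []
moves (suc k) = concatMap (λ w → (right ∷ w) ∷ (up ∷ w) ∷ []) (moves k)

_≟V_ = ≡-dec ℤ._≟_ ℤ._≟_

module _ {c ℓ : Level} (R : CommutativeRing c ℓ) (x : ℤ → CommutativeRing.Carrier R) where
  open CommutativeRing R

  edgeWeight : Vertex → Move → Carrier
  edgeWeight (i , j) right = x j - x (i ℤ.+ j)
  edgeWeight (i , j) up    = 1#

  pathWeight : Vertex → List Move → Carrier
  pathWeight u []      = 1#
  pathWeight u (s ∷ w) = edgeWeight u s * pathWeight (step s u) w

  sumPaths : Vertex → Vertex → List (List Move) → Carrier
  sumPaths u v []       = 0#
  sumPaths u v (w ∷ ws) =
    (if ⌊ endpoint u w ≟V v ⌋ then pathWeight u w else 0#) + sumPaths u v ws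

  -- e(u,v): every edge raises the coordinate sum by exactly 1, so every
  -- path from u to v has length (v₁+v₂)-(u₁+u₂); sum over all such paths.
  e : Vertex → Vertex → Carrier
  e (i , j) (k , l) with (k ℤ.+ l) ℤ.- (i ℤ.+ j)
  ... | + d      = sumPaths (i , j) (k , l) (moves d)
  ... | -[1+ _ ] = 0#

  prodRange : ℕ → ℕ → Carrier
  prodRange lo zero      = 1#
  prodRange lo (suc len) = (x (+ 1) - x (+ lo)) * prodRange (suc lo) len

-- Every path from a to (m, n) ends with an edge from (m - 1, n) or from (m, n - 1), so
-- e(a, (m, n)) = e(a, (m - 1, n)) (x_n - x_{m+n-1}) + e(a, (m, n - 1)).
-- On the boundary m = 1 or n = 1 one predecessor lies outside the quadrant reachable
-- from a; elsewhere the products satisfy the same recurrence, because the factor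
-- x_1 - x_n of the second summand combines with x_n - x_{m+n-1} into x_1 - x_{m+n-1}.
module Submission where

open import Defs
open import Level using (Level)
open import Algebra.Bundles using (CommutativeRing)
open import Data.Nat using (ℕ; suc; _<_; _∸_)
open import Data.Integer using (ℤ; +_)
open import Data.Product using (_,_)

open import Data.Product using (proj₁; proj₂)
open import Data.Nat as ℕ using (zero)
import Data.Nat.Properties as ℕ
import Data.Integer as ℤ
import Data.Integer.Properties as ℤ
open import Algebra.Properties.AbelianGroup ℤ.+-0-abelianGroup using (∙-cancelʳ)
open import Data.List using ([]; _∷_; concatMap)
open import Data.Bool using (true; false; if_then_else_)
open import Data.Empty using (⊥-elim)
open import Relation.Nullary using (yes; no)
open import Relation.Nullary.Decidable using (⌊_⌋)
open import Relation.Binary.PropositionalEquality as ≡ using (_≡_; refl; cong; cong₂)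

step-injective : ∀ s {u v} → step s u ≡ step s v → u ≡ v
step-injective right {i , j} {i′ , j′} eq =
  cong₂ _,_ (∙-cancelʳ (+ 1) i i′ (cong proj₁ eq)) (cong proj₂ eq)
step-injective up {i , j} {i′ , j′} eq =
  cong₂ _,_ (cong proj₁ eq) (∙-cancelʳ (+ 1) j j′ (cong proj₂ eq))

step-right-+ : ∀ m j → step right (+ m , j) ≡ (+ suc m , j)
step-right-+ m j = cong (λ k → (+ k , j)) (ℕ.+-comm m 1)

step-up-+ : ∀ i n → step up (i , + n) ≡ (i , + suc n)
step-up-+ i n = cong (λ k → (i , + k)) (ℕ.+-comm n 1)

proj₁-step-≤ : ∀ s u → proj₁ u ℤ.≤ proj₁ (step s u)
proj₁-step-≤ right (i , j) = ℤ.i≤i+j i (+ 1)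
proj₁-step-≤ up    (i , j) = ℤ.≤-refl

proj₂-step-≤ : ∀ s u → proj₂ u ℤ.≤ proj₂ (step s u)
proj₂-step-≤ right (i , j) = ℤ.≤-refl
proj₂-step-≤ up    (i , j) = ℤ.i≤i+j j (+ 1)

module PathSums {c ℓ : Level} (R : CommutativeRing c ℓ) (x : ℤ → CommutativeRing.Carrier R) where
  open CommutativeRing R hiding (zero) renaming (refl to ≈-refl)
  open import Relation.Binary.Reasoning.Setoid setoid
  open import Algebra.Solver.Ring.NaturalCoefficients.Default commutativeSemiring
    using (solve; _:=_; _:+_; _:*_)

  pathSum : Vertex → Vertex → ℕ → Carrier
  pathSum u v k = sumPaths R x u v (moves k)

  e≡pathSum : ∀ u v d → (proj₁ v ℤ.+ proj₂ v) ℤ.- (proj₁ u ℤ.+ proj₂ u) ≡ + d →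
              e R x u v ≡ pathSum u v d
  e≡pathSum (i , j) (k , l) d eq with (k ℤ.+ l) ℤ.- (i ℤ.+ j)
  e≡pathSum (i , j) (k , l) d refl | + .d = refl

  -- pathSum u v 0 reduces to δ u v + 0#.
  δ : Vertex → Vertex → Carrier
  δ u v = if ⌊ u ≟V v ⌋ then 1# else 0#

  δ-step : ∀ s {u v w} → step s w ≡ v → δ (step s u) v ≡ δ u w
  δ-step s {u} {v} {w} sw≡v with step s u ≟V v | u ≟V w
  ... | yes _     | yes _   = refl
  ... | yes su≡v  | no u≢w  = ⊥-elim (u≢w (step-injective s (≡.trans su≡v (≡.sym sw≡v))))
  ... | no su≢v   | yes refl = ⊥-elim (su≢v sw≡v)
  ... | no _      | no _    = refl

  edgeWeight-δ-comm : ∀ s u w → edgeWeight R x u s * δ u w ≈ δ u w * edgeWeight R x w s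
  edgeWeight-δ-comm s u w with u ≟V w
  ... | yes refl = *-comm _ _
  ... | no _     = trans (zeroʳ _) (sym (zeroˡ _))

  if-*ˡ : ∀ b a p → (if b then a * p else 0#) ≈ a * (if b then p else 0#)
  if-*ˡ true  a p = ≈-refl
  if-*ˡ false a p = sym (zeroʳ a)

  sumPaths-branch : ∀ u v ws →
    sumPaths R x u v (concatMap (λ w → (right ∷ w) ∷ (up ∷ w) ∷ []) ws)
      ≈ edgeWeight R x u right * sumPaths R x (step right u) v ws + sumPaths R x (step up u) v ws
  sumPaths-branch u v [] = sym (trans (+-congʳ (zeroʳ _)) (+-identityʳ 0#))
  sumPaths-branch u v (w ∷ ws) = begin
      (if ⌊ endpoint u′ w ≟V v ⌋ then a * pathWeight R x u′ w else 0#)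
        + ((if ⌊ endpoint u″ w ≟V v ⌋ then 1# * pathWeight R x u″ w else 0#) + rest)
    ≈⟨ +-cong (if-*ˡ _ a _) (+-congʳ (trans (if-*ˡ _ 1# _) (*-identityˡ _))) ⟩
      a * p + (q + rest)
    ≈⟨ +-congˡ (+-congˡ (sumPaths-branch u v ws)) ⟩
      a * p + (q + (a * sumPaths R x u′ v ws + sumPaths R x u″ v ws))
    ≈⟨ regroup a p q _ _ ⟩
      a * (p + sumPaths R x u′ v ws) + (q + sumPaths R x u″ v ws) ∎
    where
    u′ = step right u
    u″ = step up u
    a = edgeWeight R x u right
    p = if ⌊ endpoint u′ w ≟V v ⌋ then pathWeight R x u′ w else 0#
    q = if ⌊ endpoint u″ w ≟V v ⌋ then pathWeight R x u″ w else 0#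
    rest = sumPaths R x u v (concatMap (λ w → (right ∷ w) ∷ (up ∷ w) ∷ []) ws)
    regroup : ∀ a p q s t → a * p + (q + (a * s + t)) ≈ a * (p + s) + (q + t)
    regroup = solve 5 (λ a p q s t → (a :* p :+ (q :+ (a :* s :+ t))) := (a :* (p :+ s) :+ (q :+ t))) ≈-refl

  pathSum-suc : ∀ u v k →
    pathSum u v (suc k) ≈ edgeWeight R x u right * pathSum (step right u) v k + pathSum (step up u) v k
  pathSum-suc u v k = sumPaths-branch u v (moves k)

  pathSum-unreachable : (f : Vertex → ℤ) → (∀ s u → f u ℤ.≤ f (step s u)) →
                        ∀ k {u v} → f v ℤ.< f u → pathSum u v k ≈ 0#
  pathSum-unreachable f mono zero {u} {v} fv<fu with u ≟V v
  ... | yes refl = ⊥-elim (ℤ.<-irrefl refl fv<fu)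
  ... | no _     = +-identityʳ 0#
  pathSum-unreachable f mono (suc k) {u} {v} fv<fu = begin
      pathSum u v (suc k)
    ≈⟨ pathSum-suc u v k ⟩
      edgeWeight R x u right * pathSum (step right u) v k + pathSum (step up u) v k
    ≈⟨ +-cong (*-congˡ (unreachable-after right)) (unreachable-after up) ⟩
      edgeWeight R x u right * 0# + 0#
    ≈⟨ trans (+-identityʳ _) (zeroʳ _) ⟩
      0# ∎
    where
    unreachable-after : ∀ s → pathSum (step s u) v k ≈ 0#
    unreachable-after s = pathSum-unreachable f mono k (ℤ.<-≤-trans fv<fu (mono s u))

  pathSum-last : ∀ k u {v l d} → step right l ≡ v → step up d ≡ v →
                 pathSum u v (suc k) ≈ pathSum u l k * edgeWeight R x l right + pathSum u d k
  pathSum-last zero u {v} {l} {d} l→v d→v = begin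
      pathSum u v 1
    ≈⟨ pathSum-suc u v 0 ⟩
      a * (δ (step right u) v + 0#) + (δ (step up u) v + 0#)
    ≡⟨ cong₂ (λ r t → a * (r + 0#) + (t + 0#)) (δ-step right l→v) (δ-step up d→v) ⟩
      a * (δ u l + 0#) + (δ u d + 0#)
    ≈⟨ +-congʳ (*-congˡ (+-identityʳ _)) ⟩
      a * δ u l + (δ u d + 0#)
    ≈⟨ +-congʳ (edgeWeight-δ-comm right u l) ⟩
      δ u l * edgeWeight R x l right + (δ u d + 0#)
    ≈⟨ +-congʳ (*-congʳ (sym (+-identityʳ _))) ⟩
      (δ u l + 0#) * edgeWeight R x l right + (δ u d + 0#) ∎
    where a = edgeWeight R x u right
  pathSum-last (suc k) u {v} {l} {d} l→v d→v = begin
      pathSum u v (suc (suc k))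
    ≈⟨ pathSum-suc u v (suc k) ⟩
      a * pathSum u′ v (suc k) + pathSum u″ v (suc k)
    ≈⟨ +-cong (*-congˡ (pathSum-last k u′ l→v d→v)) (pathSum-last k u″ l→v d→v) ⟩
      a * (pathSum u′ l k * b + pathSum u′ d k) + (pathSum u″ l k * b + pathSum u″ d k)
    ≈⟨ regroup a (pathSum u′ l k) b (pathSum u′ d k) (pathSum u″ l k) (pathSum u″ d k) ⟩
      (a * pathSum u′ l k + pathSum u″ l k) * b + (a * pathSum u′ d k + pathSum u″ d k)
    ≈⟨ sym (+-cong (*-congʳ (pathSum-suc u l k)) (pathSum-suc u d k)) ⟩
      pathSum u l (suc k) * b + pathSum u d (suc k) ∎
    where
    u′ = step right u
    u″ = step up u
    a = edgeWeight R x u right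
    b = edgeWeight R x l right
    regroup : ∀ a p b q r s → a * (p * b + q) + (r * b + s) ≈ (a * p + r) * b + (a * q + s)
    regroup = solve 6 (λ a p b q r s →
      (a :* (p :* b :+ q) :+ (r :* b :+ s)) := ((a :* p :+ r) :* b :+ (a :* q :+ s))) ≈-refl

  pathSum-recurrence : ∀ k u m n →
    pathSum u (+ suc m , + suc n) (suc k)
      ≈ pathSum u (+ m , + suc n) k * (x (+ suc n) - x (+ (m ℕ.+ suc n))) + pathSum u (+ suc m , + n) k
  pathSum-recurrence k u m n = pathSum-last k u (step-right-+ m (+ suc n)) (step-up-+ (+ suc m) n)

  prodRange-snoc : ∀ lo len →
    prodRange R x lo (suc len) ≈ prodRange R x lo len * (x (+ 1) - x (+ (len ℕ.+ lo)))
  prodRange-snoc lo zero = trans (*-identityʳ _) (sym (*-identityˡ _))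
  prodRange-snoc lo (suc len) = begin
      (x (+ 1) - x (+ lo)) * prodRange R x (suc lo) (suc len)
    ≈⟨ *-congˡ (prodRange-snoc (suc lo) len) ⟩
      (x (+ 1) - x (+ lo)) * (prodRange R x (suc lo) len * (x (+ 1) - x (+ (len ℕ.+ suc lo))))
    ≈⟨ sym (*-assoc _ _ _) ⟩
      prodRange R x lo (suc len) * (x (+ 1) - x (+ (len ℕ.+ suc lo)))
    ≡⟨ cong (λ t → prodRange R x lo (suc len) * (x (+ 1) - x (+ t))) (ℕ.+-suc len lo) ⟩
      prodRange R x lo (suc len) * (x (+ 1) - x (+ (suc len ℕ.+ lo))) ∎

  [b-c]+[a-b]≈a-c : ∀ a b c → (b - c) + (a - b) ≈ a - c
  [b-c]+[a-b]≈a-c a b c = begin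
      (b - c) + (a - b)  ≈⟨ +-comm _ _ ⟩
      (a - b) + (b - c)  ≈⟨ +-assoc a (- b) (b - c) ⟩
      a + (- b + (b - c)) ≈⟨ +-congˡ (sym (+-assoc (- b) b (- c))) ⟩
      a + ((- b + b) - c) ≈⟨ +-congˡ (+-congʳ (-‿inverseˡ b)) ⟩
      a + (0# - c)       ≈⟨ +-congˡ (+-identityˡ (- c)) ⟩
      a - c              ∎

  pathSum-closedForm : ∀ m n →
    pathSum (+ 1 , + 1) (+ suc m , + suc n) (m ℕ.+ n) ≈ prodRange R x (suc (suc n)) m
  pathSum-closedForm zero zero = +-identityʳ 1#
  pathSum-closedForm zero (suc n) = begin
      pathSum a (+ 1 , + suc (suc n)) (suc n)
    ≈⟨ pathSum-recurrence n a 0 (suc n) ⟩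
      pathSum a (+ 0 , + suc (suc n)) n * _ + pathSum a (+ 1 , + suc n) n
    ≈⟨ +-cong (*-congʳ (pathSum-unreachable proj₁ proj₁-step-≤ n (ℤ.+<+ (ℕ.s≤s ℕ.z≤n))))
              (pathSum-closedForm zero n) ⟩
      0# * _ + 1#
    ≈⟨ trans (+-congʳ (zeroˡ _)) (+-identityˡ 1#) ⟩
      1# ∎
    where a = (+ 1 , + 1)
  pathSum-closedForm (suc m) zero = begin
      pathSum a (+ suc (suc m) , + 1) (suc (m ℕ.+ 0))
    ≈⟨ pathSum-recurrence (m ℕ.+ 0) a (suc m) 0 ⟩
      pathSum a (+ suc m , + 1) (m ℕ.+ 0) * (x (+ 1) - x (+ (suc m ℕ.+ 1)))
        + pathSum a (+ suc (suc m) , + 0) (m ℕ.+ 0)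
    ≈⟨ +-cong (*-congʳ (pathSum-closedForm m zero))
              (pathSum-unreachable proj₂ proj₂-step-≤ (m ℕ.+ 0) (ℤ.+<+ (ℕ.s≤s ℕ.z≤n))) ⟩
      prodRange R x 2 m * (x (+ 1) - x (+ (suc m ℕ.+ 1))) + 0#
    ≈⟨ +-identityʳ _ ⟩
      prodRange R x 2 m * (x (+ 1) - x (+ (suc m ℕ.+ 1)))
    ≡⟨ cong (λ t → prodRange R x 2 m * (x (+ 1) - x (+ t))) (≡.sym (ℕ.+-suc m 1)) ⟩
      prodRange R x 2 m * (x (+ 1) - x (+ (m ℕ.+ 2)))
    ≈⟨ sym (prodRange-snoc 2 m) ⟩
      prodRange R x 2 (suc m) ∎
    where a = (+ 1 , + 1)
  pathSum-closedForm (suc m) (suc n) = begin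
      pathSum a (+ suc (suc m) , + suc (suc n)) (suc (m ℕ.+ suc n))
    ≈⟨ pathSum-recurrence (m ℕ.+ suc n) a (suc m) (suc n) ⟩
      pathSum a (+ suc m , + suc (suc n)) (m ℕ.+ suc n) * (x (+ suc (suc n)) - x (+ top))
        + pathSum a (+ suc (suc m) , + suc n) (m ℕ.+ suc n)
    ≈⟨ +-congˡ (reflexive (cong (pathSum a (+ suc (suc m) , + suc n)) (ℕ.+-suc m n))) ⟩
      pathSum a (+ suc m , + suc (suc n)) (m ℕ.+ suc n) * (x (+ suc (suc n)) - x (+ top))
        + pathSum a (+ suc (suc m) , + suc n) (suc m ℕ.+ n)
    ≈⟨ +-cong (*-congʳ (pathSum-closedForm m (suc n))) (pathSum-closedForm (suc m) n) ⟩
      Q * (x (+ suc (suc n)) - x (+ top)) + (x (+ 1) - x (+ suc (suc n))) * Q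
    ≈⟨ +-congˡ (*-comm _ Q) ⟩
      Q * (x (+ suc (suc n)) - x (+ top)) + Q * (x (+ 1) - x (+ suc (suc n)))
    ≈⟨ sym (distribˡ Q _ _) ⟩
      Q * ((x (+ suc (suc n)) - x (+ top)) + (x (+ 1) - x (+ suc (suc n))))
    ≈⟨ *-congˡ ([b-c]+[a-b]≈a-c _ _ _) ⟩
      Q * (x (+ 1) - x (+ top))
    ≡⟨ cong (λ t → Q * (x (+ 1) - x (+ t))) (≡.sym (ℕ.+-suc m (suc (suc n)))) ⟩
      Q * (x (+ 1) - x (+ (m ℕ.+ suc (suc (suc n)))))
    ≈⟨ sym (prodRange-snoc (suc (suc (suc n))) m) ⟩
      prodRange R x (suc (suc (suc n))) (suc m) ∎
    where
    a = (+ 1 , + 1)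
    top = suc m ℕ.+ suc (suc n)
    Q = prodRange R x (suc (suc (suc n))) m

mainTheorem1 : ∀ {c ℓ : Level} (R : CommutativeRing c ℓ) (x : ℤ → CommutativeRing.Carrier R)
    (m n : ℕ) → 0 < m → 0 < n →
    CommutativeRing._≈_ R (e R x (+ 1 , + 1) (+ m , + n)) (prodRange R x (suc n) (m ∸ 1))
mainTheorem1 R x (suc m) (suc n) _ _ =
  CommutativeRing.trans R
    (CommutativeRing.reflexive R (e≡pathSum (+ 1 , + 1) (+ suc m , + suc n) (m ℕ.+ n) pathLength))
    (pathSum-closedForm m n)
  where
  open PathSums R x
  pathLength : (+ suc m ℤ.+ + suc n) ℤ.- (+ 1 ℤ.+ + 1) ≡ + (m ℕ.+ n)
  pathLength = cong (λ k → + suc k ℤ.- + 2) (ℕ.+-suc m n)
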